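{- Let $R < 10/7$ be a real number, $\lambda$ a positive integer, and $\mathcal{F} = \{F^c_{t,k}\}$ an F-system such that $|F^A_t \cup F^B_t| \le R t + \lambda$ for every positive integer $t$. Then for every even positive integer $t$, $|S_{2t} \setminus Z_{3t,2t}| \ge |S_t \cup Z_{3t/2,t}| + |S_{2t,t}|$.
   Context: An F-system is a family $\mathcal{F} = \{F^c_{t,k}\}$ of sets of positive integers, indexed by $c \in \{A,B\}$ and integers $t,k$ with $0 < k \le t$, such that (F1) $|F^c_{t,k}| \ge k$ for all $c,t,k$, and (F2) $F^A_{t,k} \cap F^B_{t',k'} = \emptyset$ for all $k,t,k',t'$ with $k + k' \le \max(t,t')$. For $c \in \{A,B\}$ and a positive integer $t$, $F^c_t = \bigcup_{\kappa \le \tau \le t} F^c_{\tau,\kappa}$ (union over integers $0<\kappa\le\tau\le t$), $S_t = F^A_t \cap F^B_t$, and $S_{2t,t} = S_{2t} \cap (F^A_{2t,t} \cup F^B_{2t,t})$. For even positive $t$, $Z_{3t/2,t} = F^A_{3t/2,t} \cap F^B_{3t/2,t}$; likewise $Z_{3t,2t} = F^A_{3t,2t} \cap F^B_{3t,2t}$.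
   Formalization: The parameter R ranges over the rationals rather than the reals. -}

module Defs where

open import Data.Nat using (ℕ; zero; suc; _+_; _≤_; _<_; _⊔_)
open import Data.Nat.Properties using (_≟_)
open import Data.List using (List; []; _∷_; _++_; filter; length; deduplicate)
open import Data.List.Membership.DecPropositional _≟_ using (_∈_; _∈?_; _∉?_)
open import Data.List.Relation.Unary.All using (All)
open import Data.Empty using (⊥)

data Colour : Set where
  A B : Colour

-- Finite sets of naturals are represented by lists (duplicates allowed);
-- set operations and cardinality are computed up to duplicates.
∣_∣ : List ℕ → ℕ
∣ xs ∣ = length (deduplicate _≟_ xs)

_∪_ : List ℕ → List ℕ → List ℕ
xs ∪ ys = xs ++ ys

_∩_ : List ℕ → List ℕ → List ℕ
xs ∩ ys = filter (_∈? ys) xs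

_∖_ : List ℕ → List ℕ → List ℕ
xs ∖ ys = filter (_∉? ys) xs

Disjoint : List ℕ → List ℕ → Set
Disjoint xs ys = ∀ x → x ∈ xs → x ∈ ys → ⊥

-- A family F c t k, meaningful for 0 < k ≤ t (other values are ignored).
Family : Set
Family = Colour → ℕ → ℕ → List ℕ

record IsFSystem (F : Family) : Set where
  field
    positive : ∀ c t k → 0 < k → k ≤ t → All (λ x → 1 ≤ x) (F c t k)
    F1 : ∀ c t k → 0 < k → k ≤ t → k ≤ ∣ F c t k ∣
    F2 : ∀ t k t' k' → 0 < k → k ≤ t → 0 < k' → k' ≤ t' →
         k + k' ≤ t ⊔ t' → Disjoint (F A t k) (F B t' k')

row : Family → Colour → ℕ → ℕ → List ℕ
row F c τ zero = []
row F c τ (suc k) = row F c τ k ∪ F c τ (suc k)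

-- F^c_t = ⋃_{0<κ≤τ≤t} F c τ κ
Fᵗ : Family → Colour → ℕ → List ℕ
Fᵗ F c zero = []
Fᵗ F c (suc t) = Fᵗ F c t ∪ row F c (suc t) (suc t)

S : Family → ℕ → List ℕ
S F t = Fᵗ F A t ∩ Fᵗ F B t

-- S_{2t,t} = S_{2t} ∩ (F^A_{2t,t} ∪ F^B_{2t,t}), written with argument t
S₂ : Family → ℕ → List ℕ
S₂ F t = S F (t + t) ∩ (F A (t + t) t ∪ F B (t + t) t)

Z : Family → ℕ → ℕ → List ℕ
Z F s k = F A s k ∩ F B s k

module Submission where

open import Defs
open import Data.Nat using (ℕ; _*_)
open import Data.Nat as ℕ using ()
open import Data.Integer using (+_)
open import Data.Rational using (ℚ; _/_; _<_; _≤_; _+_)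
open import Data.Rational as Q using ()

open import Data.Nat using (zero; suc; s≤s; z≤n; _⊔_)
open import Data.Nat.Properties
  using (≤-refl; ≤-trans; ≤-reflexive; m≤n⇒m<n∨m≡n; m<1+n⇒m≤n; m≤n⇒m≤1+n;
         m≤m+n; m≤m⊔n; m≤n⊔m; +-monoˡ-≤; +-comm; *-monoˡ-≤; *-distribʳ-+)
open import Data.Nat.Properties using (_≟_)
open import Data.List using (List; []; _∷_; _++_; length; deduplicate)
open import Data.List.Properties using (length-++; length-++-sucʳ)
open import Data.List.Membership.DecPropositional _≟_ using (_∈?_; _∉?_)
open import Data.List.Membership.Propositional using (_∈_)
open import Data.List.Membership.Propositional.Properties
  using (∈-++⁺ˡ; ∈-++⁺ʳ; ∈-++⁻; ∈-∃++; ∈-filter⁺; ∈-filter⁻; ∈-deduplicate⁺; ∈-deduplicate⁻)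
open import Data.List.Relation.Binary.Subset.Propositional using (_⊆_)
open import Data.List.Relation.Unary.Any using (here; there)
open import Data.List.Relation.Unary.All as All using ()
open import Data.List.Relation.Unary.AllPairs using (_∷_; [])
open import Data.List.Relation.Unary.Unique.Propositional using (Unique)
import Data.List.Relation.Unary.Unique.Propositional.Properties as Unique
open import Data.List.Relation.Unary.Unique.DecPropositional.Properties _≟_ using (deduplicate-!)
open import Data.Sum using (inj₁; inj₂)
open import Data.Product using (_,_; _×_; proj₁; proj₂; ∃-syntax)
open import Relation.Binary.PropositionalEquality using (_≡_; refl; sym; subst)
open import Data.Empty using (⊥; ⊥-elim)

-- Put t = 2m.  The inequality is a pure counting statement:
-- with  X = S_{2t} ∖ Z_{3t,2t},  P = S_t ∪ Z_{3t/2,t}  and  Q = S_{2t,t},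
-- both P and Q are contained in X and P, Q are disjoint, so |P| + |Q| ≤ |X|.
-- Every inclusion and the disjointness come from (F2): an element lying in
-- some F^A_{τ,κ} and some F^B_{τ',κ'} forces κ + κ' > max(τ, τ').

unique-⊆-length : (ys xs : List ℕ) → Unique ys → ys ⊆ xs → length ys ℕ.≤ length xs
unique-⊆-length []       xs u         sub = z≤n
unique-⊆-length (y ∷ ys) xs (y∉ys ∷ u) sub with ∈-∃++ (sub (here refl))
... | xs₁ , xs₂ , refl = ≤-trans (s≤s (unique-⊆-length ys (xs₁ ++ xs₂) u ys⊆xs₁xs₂))
                                 (≤-reflexive (sym (length-++-sucʳ xs₁ y xs₂)))
  where
  -- Every element of ys differs from y, so it survives the removal of y.
  ys⊆xs₁xs₂ : ys ⊆ xs₁ ++ xs₂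
  ys⊆xs₁xs₂ {z} z∈ys with ∈-++⁻ xs₁ (sub (there z∈ys))
  ... | inj₁ z∈xs₁         = ∈-++⁺ˡ z∈xs₁
  ... | inj₂ (here refl)   = ⊥-elim (All.lookup y∉ys z∈ys refl)
  ... | inj₂ (there z∈xs₂) = ∈-++⁺ʳ xs₁ z∈xs₂

disjoint-subsets-size : (X P Q : List ℕ) → P ⊆ X → Q ⊆ X →
                        (∀ {x} → x ∈ P → x ∈ Q → ⊥) → ∣ P ∣ ℕ.+ ∣ Q ∣ ℕ.≤ ∣ X ∣
disjoint-subsets-size X P Q P⊆X Q⊆X P∩Q=∅ =
  ≤-trans (≤-reflexive (sym (length-++ dP)))
          (unique-⊆-length (dP ++ dQ) (deduplicate _≟_ X) unique-dPdQ dPdQ⊆dX)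
  where
  dP dQ : List ℕ
  dP = deduplicate _≟_ P
  dQ = deduplicate _≟_ Q

  unique-dPdQ : Unique (dP ++ dQ)
  unique-dPdQ = Unique.++⁺ (deduplicate-! P) (deduplicate-! Q)
    (λ (x∈dP , x∈dQ) → P∩Q=∅ (∈-deduplicate⁻ _≟_ P x∈dP) (∈-deduplicate⁻ _≟_ Q x∈dQ))

  dPdQ⊆dX : dP ++ dQ ⊆ deduplicate _≟_ X
  dPdQ⊆dX x∈ with ∈-++⁻ dP x∈
  ... | inj₁ x∈dP = ∈-deduplicate⁺ _≟_ (P⊆X (∈-deduplicate⁻ _≟_ P x∈dP))
  ... | inj₂ x∈dQ = ∈-deduplicate⁺ _≟_ (Q⊆X (∈-deduplicate⁻ _≟_ Q x∈dQ))

data InFᵗ (F : Family) (c : Colour) (t x : ℕ) : Set where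
  witness : ∀ τ κ → 0 ℕ.< κ → κ ℕ.≤ τ → τ ℕ.≤ t → x ∈ F c τ κ → InFᵗ F c t x

row-intro : ∀ F c τ k κ {x} → 0 ℕ.< κ → κ ℕ.≤ k → x ∈ F c τ κ → x ∈ row F c τ k
row-intro F c τ zero    κ 0<κ κ≤0 x∈ with () ← ≤-trans 0<κ κ≤0
row-intro F c τ (suc k) κ 0<κ κ≤k x∈ with m≤n⇒m<n∨m≡n κ≤k
... | inj₁ κ<1+k = ∈-++⁺ˡ (row-intro F c τ k κ 0<κ (m<1+n⇒m≤n κ<1+k) x∈)
... | inj₂ refl  = ∈-++⁺ʳ (row F c τ k) x∈

row-elim : ∀ F c τ k {x} → x ∈ row F c τ k → ∃[ κ ] (0 ℕ.< κ × κ ℕ.≤ k × x ∈ F c τ κ)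
row-elim F c τ (suc k) x∈ with ∈-++⁻ (row F c τ k) x∈
... | inj₂ x∈F = suc k , s≤s z≤n , ≤-refl , x∈F
... | inj₁ x∈row with row-elim F c τ k x∈row
...   | κ , 0<κ , κ≤k , x∈F = κ , 0<κ , m≤n⇒m≤1+n κ≤k , x∈F

Fᵗ-intro : ∀ F c t τ κ {x} → 0 ℕ.< κ → κ ℕ.≤ τ → τ ℕ.≤ t → x ∈ F c τ κ → x ∈ Fᵗ F c t
Fᵗ-intro F c zero    τ κ 0<κ κ≤τ τ≤0 x∈ with () ← ≤-trans 0<κ (≤-trans κ≤τ τ≤0)
Fᵗ-intro F c (suc t) τ κ 0<κ κ≤τ τ≤t x∈ with m≤n⇒m<n∨m≡n τ≤t
... | inj₁ τ<1+t = ∈-++⁺ˡ (Fᵗ-intro F c t τ κ 0<κ κ≤τ (m<1+n⇒m≤n τ<1+t) x∈)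
... | inj₂ refl  = ∈-++⁺ʳ (Fᵗ F c t) (row-intro F c τ τ κ 0<κ κ≤τ x∈)

Fᵗ-elim : ∀ F c t {x} → x ∈ Fᵗ F c t → InFᵗ F c t x
Fᵗ-elim F c (suc t) x∈ with ∈-++⁻ (Fᵗ F c t) x∈
... | inj₂ x∈row with row-elim F c (suc t) (suc t) x∈row
...   | κ , 0<κ , κ≤τ , x∈F = witness (suc t) κ 0<κ κ≤τ ≤-refl x∈F
Fᵗ-elim F c (suc t) x∈ | inj₁ x∈Fᵗ with Fᵗ-elim F c t x∈Fᵗ
...   | witness τ κ 0<κ κ≤τ τ≤t x∈F = witness τ κ 0<κ κ≤τ (m≤n⇒m≤1+n τ≤t) x∈F

Fᵗ-mono : ∀ F c {t t'} → t ℕ.≤ t' → Fᵗ F c t ⊆ Fᵗ F c t'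
Fᵗ-mono F c {t} {t'} t≤t' x∈ with Fᵗ-elim F c t x∈
... | witness τ κ 0<κ κ≤τ τ≤t x∈F = Fᵗ-intro F c t' τ κ 0<κ κ≤τ (≤-trans τ≤t t≤t') x∈F

S-intro : ∀ F t {x} → x ∈ Fᵗ F A t → x ∈ Fᵗ F B t → x ∈ S F t
S-intro F t = ∈-filter⁺ (_∈? Fᵗ F B t)

S-elim : ∀ F t {x} → x ∈ S F t → x ∈ Fᵗ F A t × x ∈ Fᵗ F B t
S-elim F t = ∈-filter⁻ (_∈? Fᵗ F B t)

Z-elim : ∀ F s k {x} → x ∈ Z F s k → x ∈ F A s k × x ∈ F B s k
Z-elim F s k = ∈-filter⁻ (_∈? F B s k)

module Clash {F : Family} (isF : IsFSystem F) where
  open IsFSystem isF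

  clash : ∀ {t k t' k' x} → 0 ℕ.< k → k ℕ.≤ t → 0 ℕ.< k' → k' ℕ.≤ t' →
          k ℕ.+ k' ℕ.≤ t ⊔ t' → x ∈ F A t k → x ∈ F B t' k' → ⊥
  clash {t} {k} {t'} {k'} {x} 0<k k≤t 0<k' k'≤t' sum≤ = F2 t k t' k' 0<k k≤t 0<k' k'≤t' sum≤ x

  Fᵗ-A-clash : ∀ {s t' k' x} → 0 ℕ.< k' → k' ℕ.≤ t' → s ℕ.+ k' ℕ.≤ t' →
               x ∈ Fᵗ F A s → x ∈ F B t' k' → ⊥
  Fᵗ-A-clash {s} 0<k' k'≤t' s+k'≤t' x∈Fᵗ x∈F with Fᵗ-elim F A s x∈Fᵗ
  ... | witness τ κ 0<κ κ≤τ τ≤s x∈Fτκ =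
    clash 0<κ κ≤τ 0<k' k'≤t'
      (≤-trans (+-monoˡ-≤ _ (≤-trans κ≤τ τ≤s)) (≤-trans s+k'≤t' (m≤n⊔m τ _)))
      x∈Fτκ x∈F

  Fᵗ-B-clash : ∀ {s t k x} → 0 ℕ.< k → k ℕ.≤ t → k ℕ.+ s ℕ.≤ t →
               x ∈ F A t k → x ∈ Fᵗ F B s → ⊥
  Fᵗ-B-clash {s} {t} {k} 0<k k≤t k+s≤t x∈F x∈Fᵗ with Fᵗ-elim F B s x∈Fᵗ
  ... | witness τ κ 0<κ κ≤τ τ≤s x∈Fτκ =
    clash 0<k k≤t 0<κ κ≤τ
      (≤-trans (≤-trans (≤-reflexive (+-comm k κ)) (+-monoˡ-≤ k (≤-trans κ≤τ τ≤s)))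
               (≤-trans (≤-reflexive (+-comm s k)) (≤-trans k+s≤t (m≤m⊔n t τ))))
      x∈F x∈Fτκ

scale : ∀ {a b} m → a ℕ.≤ b → a * m ℕ.≤ b * m
scale m = *-monoˡ-≤ m

scale-+ : ∀ a b m → a * m ℕ.+ b * m ℕ.≤ (a ℕ.+ b) * m
scale-+ a b m = ≤-reflexive (sym (*-distribʳ-+ m a b))

scale-pos : ∀ a m → 0 ℕ.< m → 0 ℕ.< suc a * m
scale-pos a m 0<m = ≤-trans 0<m (m≤m+n m (a * m))

module Doubling {F : Family} (isF : IsFSystem F) (m : ℕ) (0<m : 0 ℕ.< m) where
  open Clash isF

  X P Q : List ℕ
  X = S F (4 * m) ∖ Z F (6 * m) (4 * m)
  P = S F (2 * m) ∪ Z F (3 * m) (2 * m)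
  Q = S₂ F (2 * m)

  0<2m : 0 ℕ.< 2 * m
  0<2m = scale-pos 1 m 0<m

  0<4m : 0 ℕ.< 4 * m
  0<4m = scale-pos 3 m 0<m

  2m≤3m : 2 * m ℕ.≤ 3 * m
  2m≤3m = scale m (m≤m+n 2 1)

  2m≤4m : 2 * m ℕ.≤ 4 * m
  2m≤4m = scale m (m≤m+n 2 2)

  3m≤4m : 3 * m ℕ.≤ 4 * m
  3m≤4m = scale m (m≤m+n 3 1)

  4m≤6m : 4 * m ℕ.≤ 6 * m
  4m≤6m = scale m (m≤m+n 4 2)

  X-intro : ∀ {x} → x ∈ S F (4 * m) →
            (x ∈ F A (6 * m) (4 * m) → x ∈ F B (6 * m) (4 * m) → ⊥) → x ∈ X
  X-intro x∈S notZ = ∈-filter⁺ (_∉? Z F (6 * m) (4 * m)) x∈S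
    (λ x∈Z → let (x∈A , x∈B) = Z-elim F (6 * m) (4 * m) x∈Z in notZ x∈A x∈B)

  -- S_{2t,t} is defined with index t + t; here t + t = 4m.
  Q-elim : ∀ {x} → x ∈ Q → x ∈ S F (4 * m) × (x ∈ F A (4 * m) (2 * m) ∪ F B (4 * m) (2 * m))
  Q-elim {x} x∈Q with ∈-filter⁻ (_∈? (F A (2 * m ℕ.+ 2 * m) (2 * m) ∪ F B (2 * m ℕ.+ 2 * m) (2 * m))) x∈Q
  ... | x∈S , x∈AB = subst (λ s → x ∈ S F s) 2m+2m≡4m x∈S
                   , subst (λ s → x ∈ F A s (2 * m) ∪ F B s (2 * m)) 2m+2m≡4m x∈AB
    where
    2m+2m≡4m : 2 * m ℕ.+ 2 * m ≡ 4 * m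
    2m+2m≡4m = sym (*-distribʳ-+ m 2 2)

  -- S_t ⊆ S_{2t} and Z_{3t/2,t} ⊆ S_{2t}; neither meets Z_{3t,2t} by (F2).
  P⊆X : P ⊆ X
  P⊆X x∈P with ∈-++⁻ (S F (2 * m)) x∈P
  ... | inj₁ x∈S with S-elim F (2 * m) x∈S
  ...   | x∈Aᵗ , x∈Bᵗ =
    X-intro (S-intro F (4 * m) (Fᵗ-mono F A 2m≤4m x∈Aᵗ) (Fᵗ-mono F B 2m≤4m x∈Bᵗ))
            (λ _ x∈B → Fᵗ-A-clash {s = 2 * m} 0<4m 4m≤6m (scale-+ 2 4 m) x∈Aᵗ x∈B)
  P⊆X x∈P | inj₂ x∈Z with Z-elim F (3 * m) (2 * m) x∈Z
  ...   | x∈A , x∈B =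
    X-intro (S-intro F (4 * m) (Fᵗ-intro F A (4 * m) (3 * m) (2 * m) 0<2m 2m≤3m 3m≤4m x∈A)
                               (Fᵗ-intro F B (4 * m) (3 * m) (2 * m) 0<2m 2m≤3m 3m≤4m x∈B))
            (λ _ x∈B′ → clash 0<2m 2m≤3m 0<4m 4m≤6m
                          (≤-trans (scale-+ 2 4 m) (m≤n⊔m (3 * m) (6 * m))) x∈A x∈B′)

  -- An element of S_{2t,t} lies in F^c_{2t,t}, which (F2) separates from Z_{3t,2t}.
  Q⊆X : Q ⊆ X
  Q⊆X {x} x∈Q with Q-elim x∈Q
  ... | x∈S , x∈AB = X-intro x∈S separated
    where
    separated : x ∈ F A (6 * m) (4 * m) → x ∈ F B (6 * m) (4 * m) → ⊥
    separated x∈A₆ x∈B₆ with ∈-++⁻ (F A (4 * m) (2 * m)) x∈AB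
    ... | inj₁ x∈A₄ = clash 0<2m 2m≤4m 0<4m 4m≤6m
                        (≤-trans (scale-+ 2 4 m) (m≤n⊔m (4 * m) (6 * m))) x∈A₄ x∈B₆
    ... | inj₂ x∈B₄ = clash 0<4m 4m≤6m 0<2m 2m≤4m
                        (≤-trans (scale-+ 4 2 m) (m≤m⊔n (6 * m) (4 * m))) x∈A₆ x∈B₄

  -- Elements of S_t or Z_{3t/2,t} are separated by (F2) from F^A_{2t,t} and F^B_{2t,t}.
  P∩Q=∅ : ∀ {x} → x ∈ P → x ∈ Q → ⊥
  P∩Q=∅ x∈P x∈Q with Q-elim x∈Q
  ... | _ , x∈AB with ∈-++⁻ (S F (2 * m)) x∈P | ∈-++⁻ (F A (4 * m) (2 * m)) x∈AB
  ...   | inj₁ x∈S | inj₁ x∈A₄ =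
    Fᵗ-B-clash {s = 2 * m} 0<2m 2m≤4m (scale-+ 2 2 m) x∈A₄ (S-elim F (2 * m) x∈S .proj₂)
  ...   | inj₁ x∈S | inj₂ x∈B₄ =
    Fᵗ-A-clash {s = 2 * m} 0<2m 2m≤4m (scale-+ 2 2 m) (S-elim F (2 * m) x∈S .proj₁) x∈B₄
  ...   | inj₂ x∈Z | inj₁ x∈A₄ =
    clash 0<2m 2m≤4m 0<2m 2m≤3m (≤-trans (scale-+ 2 2 m) (m≤m⊔n (4 * m) (3 * m)))
          x∈A₄ (Z-elim F (3 * m) (2 * m) x∈Z .proj₂)
  ...   | inj₂ x∈Z | inj₂ x∈B₄ =
    clash 0<2m 2m≤3m 0<2m 2m≤4m (≤-trans (scale-+ 2 2 m) (m≤n⊔m (3 * m) (4 * m)))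
          (Z-elim F (3 * m) (2 * m) x∈Z .proj₁) x∈B₄

lemma4 : (R : ℚ) → R < (+ 10) / 7 → (λ′ : ℕ) → 1 ℕ.≤ λ′ →
         (F : Family) → IsFSystem F →
         (∀ t → 1 ℕ.≤ t → (+ ∣ Fᵗ F A t ∪ Fᵗ F B t ∣) / 1 ≤ R Q.* ((+ t) / 1) + (+ λ′) / 1) →
         ∀ m → 1 ℕ.≤ m →
         ∣ S F (4 * m) ∖ Z F (6 * m) (4 * m) ∣
           ℕ.≥ ∣ S F (2 * m) ∪ Z F (3 * m) (2 * m) ∣ ℕ.+ ∣ S₂ F (2 * m) ∣
lemma4 _ _ _ _ F isF _ m 0<m = disjoint-subsets-size X P Q P⊆X Q⊆X P∩Q=∅
  where open Doubling isF m 0<m
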